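{- Let $(\mathsf P,\mathcal O)$ be a semitopology and $T\subseteq\mathsf P$. Then $T$ is topen if and only if $T$ is a nonempty open set and $p\between p'$ (i.e. $p$ and $p'$ are intertwined) for every $p,p'\in T$.
   Context: A semitopology $(\mathsf P,\mathcal O)$: a set $\mathsf P$ with a family $\mathcal O\subseteq\mathcal P(\mathsf P)$ of open sets containing $\varnothing$ and $\mathsf P$ and closed under arbitrary unions (not necessarily intersections). Write $X\between Y$ for $X\cap Y\neq\varnothing$. $T\subseteq\mathsf P$ is transitive when for all $O,O'\in\mathcal O$, $O\between T$ and $T\between O'$ imply $O\between O'$; a topen is a nonempty open transitive set. Points $p,p'$ are intertwined, written $p\between p'$, when for all $O,O'\in\mathcal O$ with $p\in O$ and $p'\in O'$ we have $O\between O'$ (equivalently, $\{p,p'\}$ is transitive). -}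

module Defs where

open import Level using (Level; suc; _⊔_; 0ℓ)
open import Data.Product using (Σ; ∃; _×_; _,_)
open import Data.Empty using (⊥)
open import Data.Unit using (⊤)
open import Relation.Unary using (Pred; _∈_; _⊆_; Satisfiable)

-- Not necessarily closed
-- under intersection.
record Semitopology : Set₂ where
  field
    Carrier   : Set
    Open      : Pred Carrier 0ℓ → Set₁
    open-∅    : Open (λ _ → ⊥)
    open-full : Open (λ _ → ⊤)
    open-⋃    : (I : Set) (U : I → Pred Carrier 0ℓ) →
                (∀ i → Open (U i)) → Open (λ p → Σ I (λ i → p ∈ U i))

module _ (S : Semitopology) where
  open Semitopology S

  _≬_ : Pred Carrier 0ℓ → Pred Carrier 0ℓ → Set
  X ≬ Y = ∃ λ p → p ∈ X × p ∈ Y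

  Nonempty : Pred Carrier 0ℓ → Set
  Nonempty T = ∃ λ p → p ∈ T

  Transitive : Pred Carrier 0ℓ → Set₁
  Transitive T = (O O' : Pred Carrier 0ℓ) → Open O → Open O' →
                 O ≬ T → T ≬ O' → O ≬ O'

  Topen : Pred Carrier 0ℓ → Set₁
  Topen T = Nonempty T × Open T × Transitive T

  Intertwined : Carrier → Carrier → Set₁
  Intertwined p p' = (O O' : Pred Carrier 0ℓ) → Open O → Open O' →
                     p ∈ O → p' ∈ O' → O ≬ O'

module Submission where

open import Defs
open import Data.Product using (_×_; _,_)
open import Relation.Unary using (Pred; _∈_)
open import Level using (0ℓ)

module _ (S : Semitopology) where
  open Semitopology S

  PairwiseIntertwined : Pred Carrier 0ℓ → Set₁
  PairwiseIntertwined T = ∀ p p' → p ∈ T → p' ∈ T → Intertwined S p p'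

  transitive⇒pairwiseIntertwined : ∀ {T} → Transitive S T → PairwiseIntertwined T
  transitive⇒pairwiseIntertwined tr p p' p∈T p'∈T O O' open-O open-O' p∈O p'∈O' =
    tr O O' open-O open-O' (p , p∈O , p∈T) (p' , p'∈T , p'∈O')

  pairwiseIntertwined⇒transitive : ∀ {T} → PairwiseIntertwined T → Transitive S T
  pairwiseIntertwined⇒transitive tw O O' open-O open-O' (p , p∈O , p∈T) (p' , p'∈T , p'∈O') =
    tw p p' p∈T p'∈T O O' open-O open-O' p∈O p'∈O'

proposition3p32 : (S : Semitopology) (T : Pred (Semitopology.Carrier S) 0ℓ) →
    (Topen S T → Nonempty S T × Semitopology.Open S T
    × (∀ p p' → p ∈ T → p' ∈ T → Intertwined S p p'))
    × (Nonempty S T × Semitopology.Open S T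
    × (∀ p p' → p ∈ T → p' ∈ T → Intertwined S p p') → Topen S T)
proposition3p32 S T = topen⇒intertwined , intertwined⇒topen
  where
    topen⇒intertwined : Topen S T → Nonempty S T × Semitopology.Open S T × PairwiseIntertwined S T
    topen⇒intertwined (ne , open-T , tr) = ne , open-T , transitive⇒pairwiseIntertwined S tr

    intertwined⇒topen : Nonempty S T × Semitopology.Open S T × PairwiseIntertwined S T → Topen S T
    intertwined⇒topen (ne , open-T , tw) = ne , open-T , pairwiseIntertwined⇒transitive S tw
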